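{- Let $\mathcal{M}$ be an irreducible finite set of $n\times n$ NZ matrices, let $A\in\mathcal{M}$ and $i,j\in[n]$. Then there exists a matrix $B\in\mathcal{M}^{n-1}$ such that $\mathrm{supp}(A_{*i})\subseteq \mathrm{supp}((AB)_{*j})$.
   Context: All matrices are nonnegative; $[n]=\{1,\dots,n\}$. A matrix is NZ if every row and every column has at least one positive entry. $A_{*i}$ denotes the $i$-th column of $A$, and the support of a nonnegative vector $v$ is $\mathrm{supp}(v)=\{i: v_i>0\}$. A set $\{M_1,\dots,M_m\}$ is irreducible if the matrix $\sum_i M_i$ is irreducible (for all $i,j$ there is $k$ with $((\sum_i M_i)^k)_{ij}>0$). $\mathcal{M}^{d}$ denotes the set of all products of at most $d$ matrices from $\mathcal{M}$, where the empty product (the identity matrix) is counted as a product of length $0$.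
   Formalization: The matrices in $\mathcal{M}$ have nonnegative rational entries. -}

module Defs where

open import Data.Nat using (ℕ; zero; suc)
open import Data.Fin using (Fin; zero; suc; _≟_)
open import Data.Rational using (ℚ; 0ℚ; 1ℚ; _+_; _*_; _≤_; _<_)
open import Data.Product using (_×_; ∃)
open import Data.List using (List; []; _∷_)
open import Relation.Nullary using (yes; no)

Matrix : ℕ → Set
Matrix n = Fin n → Fin n → ℚ

sumFin : ∀ {n} → (Fin n → ℚ) → ℚ
sumFin {zero}  f = 0ℚ
sumFin {suc n} f = f zero + sumFin (λ k → f (suc k))

_*M_ : ∀ {n} → Matrix n → Matrix n → Matrix n
(A *M B) i j = sumFin (λ k → A i k * B k j)

_+M_ : ∀ {n} → Matrix n → Matrix n → Matrix n
(A +M B) i j = A i j + B i j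

zeroM : ∀ {n} → Matrix n
zeroM i j = 0ℚ

idM : ∀ {n} → Matrix n
idM i j with i ≟ j
... | yes _ = 1ℚ
... | no  _ = 0ℚ

_^M_ : ∀ {n} → Matrix n → ℕ → Matrix n
A ^M zero  = idM
A ^M suc k = A *M (A ^M k)

Nonneg : ∀ {n} → Matrix n → Set
Nonneg A = ∀ i j → 0ℚ ≤ A i j

NZ : ∀ {n} → Matrix n → Set
NZ A = (∀ i → ∃ λ j → 0ℚ < A i j) × (∀ j → ∃ λ i → 0ℚ < A i j)

sumFam : ∀ {n m} → (Fin m → Matrix n) → Matrix n
sumFam {m = zero}  Ms = zeroM
sumFam {m = suc m} Ms = Ms zero +M sumFam (λ k → Ms (suc k))

IrreducibleM : ∀ {n} → Matrix n → Set
IrreducibleM S = ∀ i j → ∃ λ k → 0ℚ < (S ^M k) i j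

IrreducibleSet : ∀ {n m} → (Fin m → Matrix n) → Set
IrreducibleSet Ms = IrreducibleM (sumFam Ms)

prodWord : ∀ {n m} → (Fin m → Matrix n) → List (Fin m) → Matrix n
prodWord Ms []       = idM
prodWord Ms (k ∷ ks) = Ms k *M prodWord Ms ks

ColSuppSub : ∀ {n} → Matrix n → Fin n → Matrix n → Fin n → Set
ColSuppSub A i C j = ∀ r → 0ℚ < A r i → 0ℚ < C r j

-- Irreducibility of Σ M gives, for every i and j, a walk from i to j in the support graph of the
-- family (an edge r → s labelled l whenever (M_l)_{rs} > 0).  Erasing its loops leaves a path
-- with pairwise distinct vertices, hence at most n vertices and n - 1 edges, and the product B of
-- its labels has B_{ij} > 0.  Then (AB)_{rj} ≥ A_{ri} B_{ij} > 0 whenever A_{ri} > 0.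
module Submission where

open import Defs
open import Data.Nat using (ℕ; _≤_; _∸_; zero; suc)
open import Data.Nat.Properties using (∸-monoˡ-≤)
open import Data.Fin using (Fin; zero; suc; _≟_)
open import Data.Fin.Properties using (injective⇒≤)
open import Data.List using (List; length; lookup; []; _∷_)
open import Data.List.Membership.Propositional using (_∈_)
open import Data.List.Membership.Propositional.Properties using (∈-lookup)
open import Data.List.Relation.Unary.Any using (here; there)
open import Data.List.Relation.Unary.All as All using ()
open import Data.List.Relation.Unary.All.Properties using (¬Any⇒All¬)
open import Data.List.Relation.Unary.AllPairs using ([]; _∷_)
open import Data.List.Relation.Unary.Unique.Propositional using (Unique)
open import Data.Product using (Σ; _×_; _,_; ∃)
open import Data.Sum using (_⊎_; inj₁; inj₂)
open import Data.Empty using (⊥-elim)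
open import Data.Rational using (ℚ; 0ℚ; 1ℚ; _+_; _*_; _<_; nonNegative; nonPositive; positive)
import Data.Rational as ℚ
open import Data.Rational.Properties
  using ( _<?_; ≮⇒≥; <-irrefl; <-≤-trans; ≤-refl; *-zeroˡ; *-zeroʳ
        ; *-cancelˡ-<-nonNeg; *-cancelʳ-<-nonNeg; nonNegative⁻¹; nonPositive⁻¹; positive⁻¹
        ; nonNeg+nonNeg⇒nonNeg; pos+nonNeg⇒pos; nonNeg+pos⇒pos; nonPos+nonPos⇒nonPos
        ; nonNeg*nonNeg⇒nonNeg; pos*pos⇒pos )
open import Function.Definitions using (Injective)
open import Relation.Nullary using (yes; no)
open import Relation.Binary.PropositionalEquality using (_≡_; refl; sym; cong; subst)

+-nonNeg : ∀ {x y} → 0ℚ ℚ.≤ x → 0ℚ ℚ.≤ y → 0ℚ ℚ.≤ x + y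
+-nonNeg {x} {y} 0≤x 0≤y =
  nonNegative⁻¹ _ {{nonNeg+nonNeg⇒nonNeg x {{nonNegative 0≤x}} y {{nonNegative 0≤y}}}}

+-pos-nonNeg : ∀ {x y} → 0ℚ < x → 0ℚ ℚ.≤ y → 0ℚ < x + y
+-pos-nonNeg {x} {y} 0<x 0≤y =
  positive⁻¹ _ {{pos+nonNeg⇒pos x {{positive 0<x}} y {{nonNegative 0≤y}}}}

+-nonNeg-pos : ∀ {x y} → 0ℚ ℚ.≤ x → 0ℚ < y → 0ℚ < x + y
+-nonNeg-pos {x} {y} 0≤x 0<y =
  positive⁻¹ _ {{nonNeg+pos⇒pos x {{nonNegative 0≤x}} y {{positive 0<y}}}}

*-nonNeg : ∀ {x y} → 0ℚ ℚ.≤ x → 0ℚ ℚ.≤ y → 0ℚ ℚ.≤ x * y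
*-nonNeg {x} {y} 0≤x 0≤y =
  nonNegative⁻¹ _ {{nonNeg*nonNeg⇒nonNeg x {{nonNegative 0≤x}} y {{nonNegative 0≤y}}}}

*-pos : ∀ {x y} → 0ℚ < x → 0ℚ < y → 0ℚ < x * y
*-pos {x} {y} 0<x 0<y = positive⁻¹ _ {{pos*pos⇒pos x {{positive 0<x}} y {{positive 0<y}}}}

+-pos⇒pos⊎pos : ∀ x y → 0ℚ < x + y → 0ℚ < x ⊎ 0ℚ < y
+-pos⇒pos⊎pos x y 0<x+y with 0ℚ <? x | 0ℚ <? y
... | yes 0<x | _       = inj₁ 0<x
... | no _    | yes 0<y = inj₂ 0<y
... | no 0≮x  | no 0≮y  = ⊥-elim (<-irrefl refl (<-≤-trans 0<x+y x+y≤0))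
  where
  x+y≤0 : x + y ℚ.≤ 0ℚ
  x+y≤0 = nonPositive⁻¹ _
    {{nonPos+nonPos⇒nonPos x {{nonPositive (≮⇒≥ 0≮x)}} y {{nonPositive (≮⇒≥ 0≮y)}}}}

*-pos⇒pos×pos : ∀ {x y} → 0ℚ ℚ.≤ x → 0ℚ ℚ.≤ y → 0ℚ < x * y → 0ℚ < x × 0ℚ < y
*-pos⇒pos×pos {x} {y} 0≤x 0≤y 0<xy =
    *-cancelʳ-<-nonNeg y {{nonNegative 0≤y}} (subst (_< x * y) (sym (*-zeroˡ y)) 0<xy)
  , *-cancelˡ-<-nonNeg x {{nonNegative 0≤x}} (subst (_< x * y) (sym (*-zeroʳ x)) 0<xy)

sumFin-nonNeg : ∀ {n} (f : Fin n → ℚ) → (∀ k → 0ℚ ℚ.≤ f k) → 0ℚ ℚ.≤ sumFin f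
sumFin-nonNeg {zero}  f 0≤f = ≤-refl
sumFin-nonNeg {suc n} f 0≤f =
  +-nonNeg (0≤f zero) (sumFin-nonNeg (λ k → f (suc k)) (λ k → 0≤f (suc k)))

sumFin-pos⇒pos : ∀ {n} (f : Fin n → ℚ) → 0ℚ < sumFin f → ∃ λ k → 0ℚ < f k
sumFin-pos⇒pos {zero}  f 0<0 = ⊥-elim (<-irrefl refl 0<0)
sumFin-pos⇒pos {suc n} f 0<Σf with +-pos⇒pos⊎pos (f zero) (sumFin (λ k → f (suc k))) 0<Σf
... | inj₁ 0<f₀ = zero , 0<f₀
... | inj₂ 0<Σf′ with sumFin-pos⇒pos (λ k → f (suc k)) 0<Σf′
...   | k , 0<fk = suc k , 0<fk

sumFin-pos : ∀ {n} (f : Fin n → ℚ) → (∀ k → 0ℚ ℚ.≤ f k) → ∀ k → 0ℚ < f k → 0ℚ < sumFin f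
sumFin-pos {suc n} f 0≤f zero 0<f₀ =
  +-pos-nonNeg 0<f₀ (sumFin-nonNeg (λ k → f (suc k)) (λ k → 0≤f (suc k)))
sumFin-pos {suc n} f 0≤f (suc k) 0<fk =
  +-nonNeg-pos (0≤f zero) (sumFin-pos (λ k → f (suc k)) (λ k → 0≤f (suc k)) k 0<fk)

sumFam-entry : ∀ {n m} (Fs : Fin m → Matrix n) i j → sumFam Fs i j ≡ sumFin (λ l → Fs l i j)
sumFam-entry {m = zero}  Fs i j = refl
sumFam-entry {m = suc m} Fs i j = cong (Fs zero i j +_) (sumFam-entry (λ l → Fs (suc l)) i j)

sumFam-nonNeg : ∀ {n m} (Fs : Fin m → Matrix n) → (∀ l → Nonneg (Fs l)) → Nonneg (sumFam Fs)
sumFam-nonNeg Fs 0≤F i j =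
  subst (0ℚ ℚ.≤_) (sym (sumFam-entry Fs i j)) (sumFin-nonNeg _ (λ l → 0≤F l i j))

sumFam-pos⇒pos : ∀ {n m} (Fs : Fin m → Matrix n) i j → 0ℚ < sumFam Fs i j → ∃ λ l → 0ℚ < Fs l i j
sumFam-pos⇒pos Fs i j 0<S = sumFin-pos⇒pos _ (subst (0ℚ <_) (sumFam-entry Fs i j) 0<S)

idM-nonNeg : ∀ {n} → Nonneg (idM {n})
idM-nonNeg i j with i ≟ j
... | yes _ = nonNegative⁻¹ 1ℚ
... | no  _ = ≤-refl

idM-pos : ∀ {n} (i : Fin n) → 0ℚ < idM i i
idM-pos i with i ≟ i
... | yes _  = positive⁻¹ 1ℚ
... | no i≢i = ⊥-elim (i≢i refl)

idM-pos⇒≡ : ∀ {n} {i j : Fin n} → 0ℚ < idM i j → i ≡ j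
idM-pos⇒≡ {i = i} {j} 0<I with i ≟ j
... | yes i≡j = i≡j
... | no  _   = ⊥-elim (<-irrefl refl 0<I)

module _ {n} {A B : Matrix n} (0≤A : Nonneg A) (0≤B : Nonneg B) where

  *M-nonNeg : Nonneg (A *M B)
  *M-nonNeg i j = sumFin-nonNeg _ (λ k → *-nonNeg (0≤A i k) (0≤B k j))

  *M-pos : ∀ {i k j} → 0ℚ < A i k → 0ℚ < B k j → 0ℚ < (A *M B) i j
  *M-pos {i} {k} {j} 0<Aik 0<Bkj =
    sumFin-pos _ (λ k → *-nonNeg (0≤A i k) (0≤B k j)) k (*-pos 0<Aik 0<Bkj)

  *M-pos⇒pos : ∀ {i j} → 0ℚ < (A *M B) i j → ∃ λ k → 0ℚ < A i k × 0ℚ < B k j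
  *M-pos⇒pos {i} {j} 0<ABij with sumFin-pos⇒pos _ 0<ABij
  ... | k , 0<AikBkj = k , *-pos⇒pos×pos (0≤A i k) (0≤B k j) 0<AikBkj

^M-nonNeg : ∀ {n} {A : Matrix n} → Nonneg A → ∀ k → Nonneg (A ^M k)
^M-nonNeg 0≤A zero    = idM-nonNeg
^M-nonNeg 0≤A (suc k) = *M-nonNeg 0≤A (^M-nonNeg 0≤A k)

prodWord-nonNeg : ∀ {n m} {Ms : Fin m → Matrix n} →
                  (∀ l → Nonneg (Ms l)) → ∀ ws → Nonneg (prodWord Ms ws)
prodWord-nonNeg 0≤M []       = idM-nonNeg
prodWord-nonNeg 0≤M (l ∷ ws) = *M-nonNeg (0≤M l) (prodWord-nonNeg 0≤M ws)

lookup-injective : ∀ {a} {A : Set a} {xs : List A} → Unique xs → Injective _≡_ _≡_ (lookup xs)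
lookup-injective {xs = x ∷ xs} (_ ∷ _)    {zero}  {zero}  _  = refl
lookup-injective {xs = x ∷ xs} (x∉xs ∷ _) {zero}  {suc j} eq =
  ⊥-elim (All.lookup x∉xs (∈-lookup j) eq)
lookup-injective {xs = x ∷ xs} (x∉xs ∷ _) {suc i} {zero}  eq =
  ⊥-elim (All.lookup x∉xs (∈-lookup i) (sym eq))
lookup-injective {xs = x ∷ xs} (_ ∷ u)    {suc i} {suc j} eq = cong suc (lookup-injective u eq)

Unique⇒length≤ : ∀ {n} {xs : List (Fin n)} → Unique xs → length xs ≤ n
Unique⇒length≤ u = injective⇒≤ (lookup-injective u)

module SupportGraph {n m} (Ms : Fin m → Matrix n) (0≤M : ∀ l → Nonneg (Ms l)) where

  open import Data.List.Membership.DecPropositional (_≟_ {n}) using (_∈?_)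

  Edge : Fin n → Fin n → Set
  Edge i k = ∃ λ l → 0ℚ < Ms l i k

  data Walk : Fin n → Fin n → Set where
    []  : ∀ {i} → Walk i i
    _∷_ : ∀ {i k j} → Edge i k → Walk k j → Walk i j

  word : ∀ {i j} → Walk i j → List (Fin m)
  word []            = []
  word ((l , _) ∷ w) = l ∷ word w

  vertices : ∀ {i j} → Walk i j → List (Fin n)
  vertices {i} []      = i ∷ []
  vertices {i} (_ ∷ w) = i ∷ vertices w

  length-vertices : ∀ {i j} (w : Walk i j) → length (vertices w) ≡ suc (length (word w))
  length-vertices []      = refl
  length-vertices (_ ∷ w) = cong suc (length-vertices w)

  prodWord-word-pos : ∀ {i j} (w : Walk i j) → 0ℚ < prodWord Ms (word w) i j
  prodWord-word-pos {i} []              = idM-pos i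
  prodWord-word-pos ((l , 0<Mlik) ∷ w) =
    *M-pos (0≤M l) (prodWord-nonNeg 0≤M (word w)) 0<Mlik (prodWord-word-pos w)

  ^M-pos⇒Walk : ∀ k {i j} → 0ℚ < (sumFam Ms ^M k) i j → Walk i j
  ^M-pos⇒Walk zero    {i} 0<Iij = subst (Walk i) (idM-pos⇒≡ 0<Iij) []
  ^M-pos⇒Walk (suc k) 0<Sᵏ⁺¹ij
    with *M-pos⇒pos (sumFam-nonNeg Ms 0≤M) (^M-nonNeg (sumFam-nonNeg Ms 0≤M) k) 0<Sᵏ⁺¹ij
  ... | t , 0<Sit , 0<Sᵏtj = sumFam-pos⇒pos Ms _ t 0<Sit ∷ ^M-pos⇒Walk k 0<Sᵏtj

  Path : Fin n → Fin n → Set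
  Path i j = Σ (Walk i j) λ w → Unique (vertices w)

  suffixFrom : ∀ {i j x} (w : Walk i j) → Unique (vertices w) → x ∈ vertices w → Path x j
  suffixFrom []      u       (here refl) = [] , u
  suffixFrom (e ∷ w) u       (here refl) = e ∷ w , u
  suffixFrom (e ∷ w) (_ ∷ u) (there x∈w) = suffixFrom w u x∈w

  loop-erase : ∀ {i j} → Walk i j → Path i j
  loop-erase []          = [] , (All.[] ∷ [])
  loop-erase {i} (e ∷ w) with loop-erase w
  ... | w′ , u with i ∈? vertices w′
  ...   | yes i∈w′ = suffixFrom w′ u i∈w′
  ...   | no  i∉w′ = e ∷ w′ , (¬Any⇒All¬ _ i∉w′ ∷ u)

  Path-length≤ : ∀ {i j} ((w , u) : Path i j) → length (word w) ≤ n ∸ 1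
  Path-length≤ (w , u) = ∸-monoˡ-≤ 1 (subst (_≤ n) (length-vertices w) (Unique⇒length≤ u))

  irreducible⇒short-pos-word : IrreducibleSet Ms → ∀ i j →
    Σ (List (Fin m)) λ ws → (length ws ≤ n ∸ 1) × 0ℚ < prodWord Ms ws i j
  irreducible⇒short-pos-word irreducible i j =
    let (k , 0<Sᵏij) = irreducible i j
        (w , u)      = loop-erase (^M-pos⇒Walk k 0<Sᵏij)
    in word w , Path-length≤ (w , u) , prodWord-word-pos w

lemma2p1 : (n m : ℕ) (Ms : Fin m → Matrix n)
    → (∀ k → Nonneg (Ms k))
    → (∀ k → NZ (Ms k))
    → IrreducibleSet Ms
    → (a : Fin m) (i j : Fin n)
    → Σ (List (Fin m)) λ ws → (length ws ≤ n ∸ 1)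
        × ColSuppSub (Ms a) i (Ms a *M prodWord Ms ws) j
lemma2p1 n m Ms 0≤M _ irreducible a i j =
  let (ws , |ws|≤n-1 , 0<Bij) = irreducible⇒short-pos-word irreducible i j
  in ws , |ws|≤n-1 , λ r 0<Ari → *M-pos (0≤M a) (prodWord-nonNeg 0≤M ws) 0<Ari 0<Bij
  where open SupportGraph Ms 0≤M
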